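{- Let $X$ be a set. The interpretation functor $I\colon\mathbb G^s_X\to\mathcal G_{\underline\Pi_X}$ defined below is dense, full and faithful.
   Context: The symmetric $X$-power: for a set $Y$, $\underline\Pi_X(Y)$ is the quotient of the product $Y^X$ by the action of $\mathrm{Aut}(X)$ permuting coordinates (the joint coequalizer of all coordinate shuffles); this gives a functor $\underline\Pi_X\colon\mathbf{Set}\to\mathbf{Set}$. The category $\mathcal G_{\underline\Pi_X}$ of $\underline\Pi_X$-graphs is the comma category $\mathbf{Set}\downarrow\underline\Pi_X$: objects are triples $(E,V,\partial)$ with sets $E,V$ and a map $\partial\colon E\to\underline\Pi_X(V)$; morphisms $(f_E,f_V)$ are pairs of maps with $\partial'\circ f_E=\underline\Pi_X(f_V)\circ\partial$. The category $\mathbb G^s_X$ has two objects $V,A$ with $\mathrm{Hom}(V,A)=X$, $\mathrm{Hom}(A,V)=\emptyset$, $\mathrm{Hom}(V,V)=\{\mathrm{id}\}$, $\mathrm{Hom}(A,A)=\mathrm{Aut}(X)$, where the composite of $x\colon V\to A$ followed by $\sigma\colon A\to A$ is $\sigma(x)$ and composition of endomorphisms of $A$ is composition of permutations. The interpretation: $I(V)=(\emptyset,1,!)$; $I(A)=(1,X,q)$ where $q$ picks the class of the tuple $(x)_{x\in X}$ in $\underline\Pi_X(X)$; for $x\in X$, $I(x)=(!,\ulcorner x\urcorner)$ (empty map on edges, picking $x$ on vertices); for $\sigma\in\mathrm{Aut}(X)$, $I(\sigma)=(\mathrm{id}_1,\sigma)$. $I$ is dense if every object $G$ of $\mathcal G_{\underline\Pi_X}$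 is the colimit of the canonical diagram $I\downarrow G\to\mathcal G_{\underline\Pi_X}$, $(c,\varphi)\mapsto I(c)$. -}

module Defs where

open import Level using (0ℓ)
open import Data.Empty using (⊥; ⊥-elim)
open import Data.Unit using (⊤; tt)
open import Data.Product using (Σ; _×_; _,_; proj₁; proj₂; ∃-syntax)
open import Function using (_∘_; id)
open import Function.Bundles using (Func; _↔_; Inverse)
open import Function.Properties.Inverse using (↔-refl; ↔-sym; ↔-trans)
open import Relation.Binary.Bundles using (Setoid)
open import Relation.Binary.PropositionalEquality as ≡ using (_≡_)

-- "Sets" are modelled constructively as setoids (level 0); maps of sets
-- are setoid morphisms 'Func', compared pointwise.

open Func

module _ (X : Set) where

  Aut : Set
  Aut = X ↔ X

  -- The symmetric X-power of a setoid Y: Y^X quotiented by the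
  -- Aut(X)-action permuting coordinates.  The equivalence relation
  -- generated by  f ~ f ∘ σ  (together with pointwise equality) is the
  -- orbit relation below.
  ΠX : Setoid 0ℓ 0ℓ → Setoid 0ℓ 0ℓ
  ΠX Y = record
    { Carrier = X → Setoid.Carrier Y
    ; _≈_ = λ f g → ∃[ σ ] (∀ x → Setoid._≈_ Y (f (Inverse.to σ x)) (g x))
    ; isEquivalence = record
      { refl = ↔-refl , λ x → Setoid.refl Y
      ; sym = λ { {f} {g} (σ , p) → ↔-sym σ , λ x →
                   Setoid.trans Y (Setoid.sym Y (p (Inverse.from σ x)))
                     (Setoid.reflexive Y (≡.cong f (Inverse.strictlyInverseˡ σ x))) }
      ; trans = λ { (σ , p) (τ , q) → ↔-trans τ σ , λ x →
                   Setoid.trans Y (p (Inverse.to τ x)) (q x) }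
      }
    }

  ΠMap : {Y Z : Setoid 0ℓ 0ℓ} → Func Y Z → Func (ΠX Y) (ΠX Z)
  ΠMap f = record
    { to = λ g → to f ∘ g
    ; cong = λ { (σ , p) → σ , λ x → cong f (p x) }
    }

  -- Π_X-graphs: objects of the comma category Set ↓ Π_X.
  record Graph : Set₁ where
    field
      E : Setoid 0ℓ 0ℓ
      V : Setoid 0ℓ 0ℓ
      ∂ : Func E (ΠX V)
  open Graph public

  record GHom (G H : Graph) : Set where
    field
      fE : Func (E G) (E H)
      fV : Func (V G) (V H)
      comm : ∀ e → Setoid._≈_ (ΠX (V H)) (to (∂ H) (to fE e)) (to (ΠMap fV) (to (∂ G) e))
  open GHom public

  _≋_ : {G H : Graph} → GHom G H → GHom G H → Set
  _≋_ {G} {H} f g =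
    (∀ e → Setoid._≈_ (E H) (to (fE f) e) (to (fE g) e)) ×
    (∀ v → Setoid._≈_ (V H) (to (fV f) v) (to (fV g) v))

  _∘G_ : {G H K : Graph} → GHom H K → GHom G H → GHom G K
  _∘G_ {G} {H} {K} g f = record
    { fE = record { to = to (fE g) ∘ to (fE f) ; cong = cong (fE g) ∘ cong (fE f) }
    ; fV = record { to = to (fV g) ∘ to (fV f) ; cong = cong (fV g) ∘ cong (fV f) }
    ; comm = λ e → Setoid.trans (ΠX (V K))
                     {to (∂ K) (to (fE g) (to (fE f) e))}
                     {to (ΠMap (fV g)) (to (∂ H) (to (fE f) e))}
                     {to (ΠMap (fV g)) (to (ΠMap (fV f)) (to (∂ G) e))}
                     (comm g (to (fE f) e))
                     (cong (ΠMap (fV g))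
                        {to (∂ H) (to (fE f) e)} {to (ΠMap (fV f)) (to (∂ G) e)}
                        (comm f e))
    }

  data Obj : Set where
    Vo Ao : Obj

  Hom : Obj → Obj → Set
  Hom Vo Vo = ⊤
  Hom Vo Ao = X
  Hom Ao Vo = ⊥
  Hom Ao Ao = Aut

  HomEq : {c d : Obj} → Hom c d → Hom c d → Set
  HomEq {Vo} {Vo} _ _ = ⊤
  HomEq {Vo} {Ao} x y = x ≡ y
  HomEq {Ao} {Vo} () _
  HomEq {Ao} {Ao} σ τ = ∀ x → Inverse.to σ x ≡ Inverse.to τ x

  _∘s_ : {a b c : Obj} → Hom b c → Hom a b → Hom a c
  _∘s_ {Vo} {Vo} {Vo} g f = tt
  _∘s_ {Vo} {Vo} {Ao} x f = x
  _∘s_ {Vo} {Ao} {Ao} σ x = Inverse.to σ x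
  _∘s_ {Ao} {Ao} {Ao} σ τ = ↔-trans τ σ
  _∘s_ {Vo} {Ao} {Vo} () _
  _∘s_ {Ao} {Vo} {_} _ ()
  _∘s_ {Ao} {Ao} {Vo} () _

  private
    fun : {A B : Set} → (A → B) → Func (≡.setoid A) (≡.setoid B)
    fun f = record { to = f ; cong = ≡.cong f }

  I₀ : Obj → Graph
  I₀ Vo = record { E = ≡.setoid ⊥ ; V = ≡.setoid ⊤
                 ; ∂ = record { to = λ () ; cong = λ { {()} } } }
  I₀ Ao = record { E = ≡.setoid ⊤ ; V = ≡.setoid X
                 ; ∂ = record { to = λ _ → id
                              ; cong = λ _ → Setoid.refl (ΠX (≡.setoid X)) } }

  I₁ : {c d : Obj} → Hom c d → GHom (I₀ c) (I₀ d)
  I₁ {Vo} {Vo} _ = record { fE = fun id ; fV = fun id ; comm = λ () }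
  I₁ {Vo} {Ao} x = record { fE = fun (λ ()) ; fV = fun (λ _ → x) ; comm = λ () }
  I₁ {Ao} {Vo} ()
  I₁ {Ao} {Ao} σ = record
    { fE = fun id
    ; fV = fun (Inverse.to σ)
    ; comm = λ _ → σ , λ x → ≡.refl
    }

  Full : Set
  Full = ∀ (c d : Obj) (h : GHom (I₀ c) (I₀ d)) → Σ (Hom c d) (λ f → _≋_ {I₀ c} {I₀ d} (I₁ f) h)

  Faithful : Set
  Faithful = ∀ (c d : Obj) (f g : Hom c d) → _≋_ {I₀ c} {I₀ d} (I₁ f) (I₁ g) → HomEq f g

  -- The comma category I ↓ G: objects (c , φ : I c → G) ...
  record Elt (G : Graph) : Set where
    constructor elt
    field
      obj : Obj
      arr : GHom (I₀ obj) G
  open Elt public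

  EltHom : {G : Graph} → Elt G → Elt G → Set
  EltHom a b = Σ (Hom (obj a) (obj b)) λ f → (arr b ∘G I₁ f) ≋ arr a

  -- Cocones over the canonical diagram I ↓ G → G_{Π_X}, (c , φ) ↦ I c,
  -- with vertex H.
  record Cocone (G H : Graph) : Set where
    field
      leg : (a : Elt G) → GHom (I₀ (obj a)) H
      nat : (a b : Elt G) (f : EltHom a b) → (leg b ∘G I₁ (proj₁ f)) ≋ leg a
  open Cocone public

  IsCanonicalColimit : Graph → Set₁
  IsCanonicalColimit G =
    ∀ (H : Graph) (κ : Cocone G H) →
      Σ (GHom G H) (λ u → ∀ a → (u ∘G arr a) ≋ leg κ a) ×
      (∀ (u u′ : GHom G H) →
         (∀ a → (u ∘G arr a) ≋ leg κ a) →
         (∀ a → (u′ ∘G arr a) ≋ leg κ a) → u ≋ u′)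

  Dense : Set₁
  Dense = ∀ (G : Graph) → IsCanonicalColimit G

module Submission where

-- An object of the comma category I ↓ G is either a vertex
-- element (V , φ), which is nothing but the vertex φ_V(*) of G, or an edge
-- element (A , φ), which is an edge e = φ_E(*) of G together with a
-- tuple φ_V that is a reordering of the boundary ∂ e.  Hence every element
-- is reached by a morphism of I ↓ G from a canonical element
-- "vertex v" or "edge e", and the canonical elements are linked to one
-- another: equal vertices / equal edges are connected by morphisms, and
-- every corner ∂ e x of an edge is connected to the edge.
--
-- Density follows: a cocone κ with vertex H
-- induces u : G → H by reading off the legs of κ at canonical elements;
-- the morphisms above show that u respects the setoid equalities and the
-- boundary maps, that u factors every leg, and uniqueness holds because
-- a graph morphism is determined by its composites with canonical
-- elements.  Fullness and faithfulness are checked on the four hom-sets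
-- of G^s_X; the only non-trivial case is that an endomorphism of I(A)
-- acts on vertices by a permutation, which is exactly its commutation
-- with the boundary map q.

open import Defs
open import Level using (0ℓ)
open import Data.Empty using (⊥-elim)
open import Data.Unit using (tt)
open import Data.Product using (_×_; _,_; proj₁; proj₂)
open import Function.Bundles using (Func; _↔_; Inverse)
open import Function.Properties.Inverse using (↔-sym; ↔-refl)
open import Relation.Binary.Bundles using (Setoid)
import Relation.Binary.PropositionalEquality as ≡

open Func

module Interpretation (X : Set) where

  fromX : {S : Setoid 0ℓ 0ℓ} → (X → Setoid.Carrier S) → Func (≡.setoid X) S
  fromX {S} f = record { to = f ; cong = λ { ≡.refl → Setoid.refl S } }

  module Elements (G : Graph X) where
    module VG = Setoid (V G)
    module EG = Setoid (E G)

    vertexArr : VG.Carrier → GHom X (I₀ X Vo) G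
    vertexArr v = record
      { fE = record { to = λ () ; cong = λ { {()} } }
      ; fV = record { to = λ _ → v ; cong = λ _ → VG.refl }
      ; comm = λ ()
      }

    vertex : VG.Carrier → Elt X G
    vertex v = elt Vo (vertexArr v)

    edgeArr : EG.Carrier → GHom X (I₀ X Ao) G
    edgeArr e = record
      { fE = record { to = λ _ → e ; cong = λ _ → EG.refl }
      ; fV = fromX {V G} (to (∂ G) e)
      ; comm = λ _ → ↔-refl , λ _ → VG.refl
      }

    edge : EG.Carrier → Elt X G
    edge e = elt Ao (edgeArr e)

    reorder : (a b : GHom X (I₀ X Ao) G) → to (fE b) tt EG.≈ to (fE a) tt →
              (σ : X ↔ X) → (∀ x → to (fV a) (Inverse.to σ x) VG.≈ to (fV b) x) →
              EltHom X (elt Ao a) (elt Ao b)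
    reorder a b same-edge σ p = ↔-sym σ , (λ _ → same-edge) , λ x →
      VG.trans (VG.sym (p (Inverse.from σ x)))
               (cong (fV a) (Inverse.strictlyInverseˡ σ x))

    vertex-≈ : {v w : VG.Carrier} → w VG.≈ v → EltHom X (vertex v) (vertex w)
    vertex-≈ w≈v = tt , (λ ()) , λ _ → w≈v

    edge-≈ : {e e′ : EG.Carrier} → e EG.≈ e′ → EltHom X (edge e) (edge e′)
    edge-≈ {e} {e′} e≈e′ =
      reorder (edgeArr e) (edgeArr e′) (EG.sym e≈e′)
              (proj₁ (cong (∂ G) e≈e′)) (proj₂ (cong (∂ G) e≈e′))

    corner : (φ : GHom X (I₀ X Ao) G) (x : X) →
             EltHom X (vertex (to (fV φ) x)) (elt Ao φ)
    corner φ x = x , (λ ()) , λ _ → VG.refl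

    vertex-covers : (φ : GHom X (I₀ X Vo) G) →
                    EltHom X (vertex (to (fV φ) tt)) (elt Vo φ)
    vertex-covers φ = tt , (λ ()) , λ _ → VG.refl

    -- Every edge element receives a morphism from a canonical one; the
    -- permutation comes from the commutation of φ with the boundary maps.
    edge-covers : (φ : GHom X (I₀ X Ao) G) →
                  EltHom X (edge (to (fE φ) tt)) (elt Ao φ)
    edge-covers φ =
      reorder (edgeArr (to (fE φ) tt)) φ EG.refl (proj₁ (comm φ tt)) (proj₂ (comm φ tt))

  dense : Dense X
  dense G H κ = (u , factors) , unique
    where
      open Elements G
      module VH = Setoid (V H)
      module EH = Setoid (E H)

      legV : {a b : Elt X G} (f : EltHom X a b) (v : Setoid.Carrier (V (I₀ X (obj a)))) →
             to (fV (leg κ b)) (to (fV (I₁ X (proj₁ f))) v) VH.≈ to (fV (leg κ a)) v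
      legV {a} {b} f = proj₂ (nat κ a b f)

      legE : {a b : Elt X G} (f : EltHom X a b) (e : Setoid.Carrier (E (I₀ X (obj a)))) →
             to (fE (leg κ b)) (to (fE (I₁ X (proj₁ f))) e) EH.≈ to (fE (leg κ a)) e
      legE {a} {b} f = proj₁ (nat κ a b f)

      uV : VG.Carrier → VH.Carrier
      uV v = to (fV (leg κ (vertex v))) tt

      uE : EG.Carrier → EH.Carrier
      uE e = to (fE (leg κ (edge e))) tt

      u-comm : ∀ e → Setoid._≈_ (ΠX X (V H)) (to (∂ H) (uE e)) (λ x → uV (to (∂ G) e x))
      u-comm e = proj₁ (comm (leg κ (edge e)) tt) , λ x →
        VH.trans (proj₂ (comm (leg κ (edge e)) tt) x) (legV (corner (edgeArr e) x) tt)

      u : GHom X G H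
      u = record
        { fE = record { to = uE ; cong = λ e≈e′ → EH.sym (legE (edge-≈ e≈e′) tt) }
        ; fV = record { to = uV ; cong = λ v≈w → VH.sym (legV (vertex-≈ (VG.sym v≈w)) tt) }
        ; comm = u-comm
        }

      factors : ∀ a → _≋_ X {I₀ X (obj a)} {H} (_∘G_ X u (arr a)) (leg κ a)
      factors (elt Vo φ) = (λ ()) , λ _ → VH.sym (legV (vertex-covers φ) tt)
      factors (elt Ao φ) = (λ _ → EH.sym (legE (edge-covers φ) tt))
                         , λ x → VH.sym (legV (corner φ x) tt)

      -- A graph morphism is determined by its composites with the
      -- canonical elements.
      unique : ∀ (w w′ : GHom X G H) →
               (∀ a → _≋_ X {I₀ X (obj a)} {H} (_∘G_ X w (arr a)) (leg κ a)) →
               (∀ a → _≋_ X {I₀ X (obj a)} {H} (_∘G_ X w′ (arr a)) (leg κ a)) →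
               _≋_ X {G} {H} w w′
      unique w w′ p p′ =
        (λ e → EH.trans (proj₁ (p (edge e)) tt) (EH.sym (proj₁ (p′ (edge e)) tt))) ,
        (λ v → VH.trans (proj₂ (p (vertex v)) tt) (VH.sym (proj₂ (p′ (vertex v)) tt)))

  -- A morphism I(c) → I(d) is the image of a morphism c → d.  For c = d = A
  -- its commutation with q says its vertex map is a permutation σ.
  full : Full X
  full Vo Vo h = tt , (λ ()) , λ _ → ≡.refl
  full Vo Ao h = to (fV h) tt , (λ ()) , λ _ → ≡.refl
  full Ao Vo h = ⊥-elim (to (fE h) tt)
  full Ao Ao h = proj₁ (comm h tt) , (λ _ → ≡.refl) , proj₂ (comm h tt)

  faithful : Faithful X
  faithful Vo Vo f g _ = tt
  faithful Vo Ao f g (_ , same-vertex) = same-vertex tt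
  faithful Ao Ao f g (_ , same-vertex) = same-vertex

lemma5p7 : (X : Set) → Dense X × Full X × Faithful X
lemma5p7 X = dense , full , faithful
  where open Interpretation X
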